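{- Let $D$ be a deck of order $n$ with symbol set $S$ and $c$ cards. If for every choice of $n$ distinct symbols $s_1,\dots,s_n\in S$ one has $\sum_{i=1}^n m(s_i)>c$, then $D$ is maximal.
   Context: A deck consists of a finite set $S$ of symbols together with a finite collection $D$ of distinct cards, each card being a subset of $S$, satisfying: (D1) any two distinct cards have exactly one symbol in common; (D2) every symbol of $S$ lies on at least two cards; (D3) every card contains at least two symbols; (D4) all cards have the same cardinality $n$ (the order); (D5) $S$ is nonempty. $c=|D|$. For $s\in S$, the multiplicity $m(s)$ is the number of cards containing $s$. A deck $D$ is maximal if there is no new card $\Gamma\subseteq S$, $\Gamma\notin D$, such that $D\cup\{\Gamma\}$ (with the same symbol set $S$) is still a deck. -}

module Defs where

open import Data.Nat using (ℕ; _+_; _≤_; _<_)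
open import Data.Fin using (Fin)
open import Data.Fin.Subset using (Subset; _∩_; ∣_∣)
open import Data.Fin.Subset.Properties using (_∈?_)
open import Data.List using (List; _∷_; length; filter; map; allFin)
open import Data.Nat.ListAction using (sum)
open import Data.List.Relation.Unary.Unique.Propositional using (Unique)
import Data.List.Membership.Propositional as LM
open import Data.Product using (∃)
open import Relation.Binary.PropositionalEquality using (_≡_; _≢_)
open import Relation.Nullary using (¬_)

mult : ∀ {k} → List (Subset k) → Fin k → ℕ
mult D s = length (filter (s ∈?_) D)

elems : ∀ {k} → Subset k → List (Fin k)
elems {k} T = filter (_∈? T) (allFin k)

multSum : ∀ {k} → List (Subset k) → Subset k → ℕ
multSum D T = sum (map (mult D) (elems T))

record IsDeck (k n : ℕ) (D : List (Subset k)) : Set where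
  field
    distinct : Unique D
    D1 : ∀ {p q} → p LM.∈ D → q LM.∈ D → p ≢ q → ∣ p ∩ q ∣ ≡ 1
    D2 : ∀ (s : Fin k) → 2 ≤ mult D s
    D3 : ∀ {p} → p LM.∈ D → 2 ≤ ∣ p ∣
    D4 : ∀ {p} → p LM.∈ D → ∣ p ∣ ≡ n
    D5 : 0 < k

Maximal : ∀ {k} → List (Subset k) → Set
Maximal {k} D = ∀ (Γ : Subset k) → ¬ (Γ LM.∈ D) → ¬ (∃ λ n' → IsDeck k n' (Γ ∷ D))

-- Double counting: for any T, the sum of the multiplicities of the symbols of T
-- is the sum over the cards p of ∣ T ∩ p ∣.  A card Γ that could be added to D
-- has n symbols and meets every card of D in exactly one symbol, so for T = Γ
-- this sum is exactly c, contradicting the hypothesis that it exceeds c.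
module Submission where

open import Defs
open import Data.Bool using (Bool; true; false; if_then_else_)
open import Data.Nat using (ℕ; zero; suc; _+_; _<_)
open import Data.Nat.Properties using (<-irrefl)
open import Data.Nat.ListAction using (sum)
open import Data.Nat.Tactic.RingSolver using (solve-∀)
open import Data.Fin using (Fin; zero; suc)
open import Data.Fin.Subset using (Subset; ∣_∣; _∩_)
open import Data.Vec using ([]; _∷_)
open import Data.Fin.Subset.Properties using (_∈?_)
open import Data.List using (List; []; _∷_; length; map; filter; tabulate; allFin)
open import Data.List.Properties using (map-∘; map-tabulate)
open import Data.List.Relation.Unary.All as All using (All; []; _∷_)
open import Data.List.Relation.Unary.Any using (here; there)
open import Data.List.Membership.Propositional using (_∈_; _∉_)
open import Data.Product using (∃; _,_)
open import Relation.Nullary using (does)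
open import Relation.Binary.PropositionalEquality
  using (_≡_; refl; sym; trans; cong; cong₂; subst; module ≡-Reasoning)

private
  variable
    k n n′ : ℕ

indicator : Subset k → Fin k → ℕ
indicator p s = if does (s ∈? p) then 1 else 0

mult-∷ : ∀ (p : Subset k) D s → mult (p ∷ D) s ≡ indicator p s + mult D s
mult-∷ p D s with does (s ∈? p)
... | true  = refl
... | false = refl

sum-map-+ : ∀ {A : Set} (f g : A → ℕ) xs →
            sum (map (λ x → f x + g x) xs) ≡ sum (map f xs) + sum (map g xs)
sum-map-+ f g []       = refl
sum-map-+ f g (x ∷ xs) = trans (cong (f x + g x +_) (sum-map-+ f g xs))
                               (interchange (f x) (g x) (sum (map f xs)) (sum (map g xs)))
  where
  interchange : ∀ a b c d → a + b + (c + d) ≡ a + c + (b + d)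
  interchange = solve-∀

sum-map-cong : ∀ {A : Set} {f g : A → ℕ} → (∀ x → f x ≡ g x) →
               ∀ xs → sum (map f xs) ≡ sum (map g xs)
sum-map-cong f≗g []       = refl
sum-map-cong f≗g (x ∷ xs) = cong₂ _+_ (f≗g x) (sum-map-cong f≗g xs)

sum-map-zero : ∀ {A : Set} (xs : List A) → sum (map (λ _ → 0) xs) ≡ 0
sum-map-zero []       = refl
sum-map-zero (x ∷ xs) = sum-map-zero xs

sum-map-≡1 : ∀ {A : Set} {f : A → ℕ} {xs} → All (λ x → f x ≡ 1) xs → sum (map f xs) ≡ length xs
sum-map-≡1 []           = refl
sum-map-≡1 (fx≡1 ∷ all) = cong₂ _+_ fx≡1 (sum-map-≡1 all)

filter-∈?-map-suc : ∀ (t : Bool) (T : Subset k) xs →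
                    filter (_∈? (t ∷ T)) (map suc xs) ≡ map suc (filter (_∈? T) xs)
filter-∈?-map-suc t T []       = refl
filter-∈?-map-suc t T (x ∷ xs) with does (x ∈? T)
... | true  = cong (suc x ∷_) (filter-∈?-map-suc t T xs)
... | false = filter-∈?-map-suc t T xs

-- elems (t ∷ T) unfolds to a filter of zero ∷ tabulate suc; this handles the tail.
sum-indicator-elems-suc : ∀ (t q : Bool) (T p : Subset k) →
  sum (map (indicator (q ∷ p)) (filter (_∈? (t ∷ T)) (tabulate suc)))
    ≡ sum (map (indicator p) (elems T))
sum-indicator-elems-suc {k} t q T p = begin
  sum (map (indicator (q ∷ p)) (filter (_∈? (t ∷ T)) (tabulate suc)))
    ≡⟨ cong (λ xs → sum (map (indicator (q ∷ p)) (filter (_∈? (t ∷ T)) xs)))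
            (sym (map-tabulate (λ x → x) suc)) ⟩
  sum (map (indicator (q ∷ p)) (filter (_∈? (t ∷ T)) (map suc (allFin k))))
    ≡⟨ cong (λ xs → sum (map (indicator (q ∷ p)) xs)) (filter-∈?-map-suc t T (allFin k)) ⟩
  sum (map (indicator (q ∷ p)) (map suc (elems T)))
    ≡⟨ cong sum (map-∘ (elems T)) ⟨
  sum (map (indicator p) (elems T))
    ∎
  where open ≡-Reasoning

sum-indicator-elems : ∀ (T p : Subset k) → sum (map (indicator p) (elems T)) ≡ ∣ T ∩ p ∣
sum-indicator-elems []          []          = refl
sum-indicator-elems (true  ∷ T) (true  ∷ p) = cong suc (trans (sum-indicator-elems-suc true true T p)
                                                                (sum-indicator-elems T p))
sum-indicator-elems (true  ∷ T) (false ∷ p) = trans (sum-indicator-elems-suc true false T p)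
                                                      (sum-indicator-elems T p)
sum-indicator-elems (false ∷ T) (q     ∷ p) = trans (sum-indicator-elems-suc false q T p)
                                                      (sum-indicator-elems T p)

multSum-double-counting : ∀ (D : List (Subset k)) T → multSum D T ≡ sum (map (λ p → ∣ T ∩ p ∣) D)
multSum-double-counting []      T = sum-map-zero (elems T)
multSum-double-counting (p ∷ D) T = begin
  sum (map (mult (p ∷ D)) (elems T))
    ≡⟨ sum-map-cong (mult-∷ p D) (elems T) ⟩
  sum (map (λ s → indicator p s + mult D s) (elems T))
    ≡⟨ sum-map-+ (indicator p) (mult D) (elems T) ⟩
  sum (map (indicator p) (elems T)) + multSum D T
    ≡⟨ cong₂ _+_ (sum-indicator-elems T p) (multSum-double-counting D T) ⟩
  ∣ T ∩ p ∣ + sum (map (λ p → ∣ T ∩ p ∣) D)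
    ∎
  where open ≡-Reasoning

deck-nonempty : ∀ {D} → IsDeck k n D → ∃ (_∈ D)
deck-nonempty {zero} deck with IsDeck.D5 deck
... | ()
deck-nonempty {suc _} {D = []} deck with IsDeck.D2 deck zero
... | ()
deck-nonempty {suc _} {D = p ∷ _} deck = p , here refl

extension-card-size : ∀ {D Γ} → IsDeck k n D → IsDeck k n′ (Γ ∷ D) → ∣ Γ ∣ ≡ n
extension-card-size deck deck′ with deck-nonempty deck
... | p , p∈D = trans (IsDeck.D4 deck′ (here refl))
                      (trans (sym (IsDeck.D4 deck′ (there p∈D))) (IsDeck.D4 deck p∈D))

extension-meets-once : ∀ {D Γ} → Γ ∉ D → IsDeck k n′ (Γ ∷ D) → All (λ p → ∣ Γ ∩ p ∣ ≡ 1) D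
extension-meets-once Γ∉D deck′ = All.tabulate λ p∈D →
  IsDeck.D1 deck′ (here refl) (there p∈D) (λ Γ≡p → Γ∉D (subst (_∈ _) (sym Γ≡p) p∈D))

mainTheorem19 : (k n : ℕ) (D : List (Subset k)) → IsDeck k n D
    → (∀ (T : Subset k) → ∣ T ∣ ≡ n → length D < multSum D T)
    → Maximal D
mainTheorem19 k n D deck hyp Γ Γ∉D (n′ , deck′) =
  <-irrefl (sym multSum≡c) (hyp Γ (extension-card-size deck deck′))
  where
  multSum≡c : multSum D Γ ≡ length D
  multSum≡c = trans (multSum-double-counting D Γ) (sum-map-≡1 (extension-meets-once Γ∉D deck′))
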